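{- $\mathcal{H}$ is computably categorical.
   Context: $\mathcal{H}=(H,\{D_i\}_{i<\omega},\{E_i\}_{i<\omega})$ is the computable structure with universe $H=[\omega]^{<\omega}\cup(\omega\times\{0,1\})$ (coded computably in $\omega$), where $[\omega]^{<\omega}$ is the set of finite subsets of $\omega$ (identified with characteristic functions, $X(i)\in\{0,1\}$). $E_i(X,Y)$ holds iff $X,Y\in[\omega]^{<\omega}$ and $X\triangle Y=\{i\}$. $D_i(X,(i,a))$ holds iff $X\in[\omega]^{<\omega}$ and $X(i)=a$; no other instances hold. A computable structure is computably categorical if between it and any computable copy there is a computable isomorphism. -}

module Defs where

open import Data.Nat using (ℕ; zero; suc; _+_; _*_; _^_; _<_; _/_; _%_)
open import Data.Fin using (Fin)
open import Data.Vec using (Vec; []; _∷_; lookup)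
open import Data.Bool using (Bool; true; false)
open import Data.Product using (Σ; _×_; _,_; ∃)
open import Relation.Binary.PropositionalEquality using (_≡_; _≢_)
open import Relation.Nullary using (¬_)
open import Function.Bundles using (_⇔_)

data Code : ℕ → Set where
  zer  : ∀ {n} → Code n
  succ : Code 1
  proj : ∀ {n} → Fin n → Code n
  comp : ∀ {n m} → Code m → Vec (Code n) m → Code n
  prec : ∀ {n} → Code n → Code (suc (suc n)) → Code (suc n)
  mu   : ∀ {n} → Code (suc n) → Code n

mutual
  data _⟦_⟧⇓_ : ∀ {n} → Code n → Vec ℕ n → ℕ → Set where
    ⇓zer  : ∀ {n} {xs : Vec ℕ n} → zer ⟦ xs ⟧⇓ 0
    ⇓succ : ∀ {x} → succ ⟦ x ∷ [] ⟧⇓ suc x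
    ⇓proj : ∀ {n} {i : Fin n} {xs} → proj i ⟦ xs ⟧⇓ lookup xs i
    ⇓comp : ∀ {n m} {f : Code m} {gs : Vec (Code n) m} {xs ys y} →
            gs ⟦ xs ⟧⇓* ys → f ⟦ ys ⟧⇓ y → comp f gs ⟦ xs ⟧⇓ y
    ⇓prec0 : ∀ {n} {g : Code n} {h} {xs y} →
             g ⟦ xs ⟧⇓ y → prec g h ⟦ 0 ∷ xs ⟧⇓ y
    ⇓precS : ∀ {n} {g : Code n} {h} {xs k r y} →
             prec g h ⟦ k ∷ xs ⟧⇓ r → h ⟦ k ∷ r ∷ xs ⟧⇓ y →
             prec g h ⟦ suc k ∷ xs ⟧⇓ y
    ⇓mu   : ∀ {n} {f : Code (suc n)} {xs z} →
            f ⟦ z ∷ xs ⟧⇓ 0 →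
            (∀ k → k < z → Σ ℕ λ m → f ⟦ k ∷ xs ⟧⇓ suc m) →
            mu f ⟦ xs ⟧⇓ z

  data _⟦_⟧⇓*_ : ∀ {n m} → Vec (Code n) m → Vec ℕ n → Vec ℕ m → Set where
    []  : ∀ {n} {xs : Vec ℕ n} → [] ⟦ xs ⟧⇓* []
    _∷_ : ∀ {n m} {g : Code n} {gs : Vec (Code n) m} {xs y ys} →
          g ⟦ xs ⟧⇓ y → gs ⟦ xs ⟧⇓* ys → (g ∷ gs) ⟦ xs ⟧⇓* (y ∷ ys)

Computable₁ : (ℕ → ℕ) → Set
Computable₁ f = Σ (Code 1) λ e → ∀ x → e ⟦ x ∷ [] ⟧⇓ f x

bool→ℕ : Bool → ℕ
bool→ℕ true  = 1
bool→ℕ false = 0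

Computable₃ : (ℕ → ℕ → ℕ → Bool) → Set
Computable₃ r = Σ (Code 3) λ e → ∀ i x y → e ⟦ i ∷ x ∷ y ∷ [] ⟧⇓ bool→ℕ (r i x y)

-- A computable structure in this signature with universe ω is given by
-- characteristic functions d, e with d i x y = true iff D_i(x,y), which are
-- computable uniformly in i (i.e. the atomic diagram is computable).

record CompStr : Set where
  field
    D : ℕ → ℕ → ℕ → Bool
    E : ℕ → ℕ → ℕ → Bool
    D-computable : Computable₃ D
    E-computable : Computable₃ E

-- The structure H, coded in ω:
--   2k       codes the finite set X ⊆ ω with X(j) = bit j of k (binary expansion)
--   2(2i+a)+1 codes the pair (i,a), for a ∈ {0,1}.

bit : ℕ → ℕ → ℕ
bit k zero    = k % 2
bit k (suc j) = bit (k / 2) j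

HE : ℕ → ℕ → ℕ → Set
HE i x y = Σ ℕ λ k → Σ ℕ λ l → x ≡ 2 * k × y ≡ 2 * l ×
           ((∀ j → j ≢ i → bit k j ≡ bit l j) × bit k i ≢ bit l i)

HD : ℕ → ℕ → ℕ → Set
HD i x y = Σ ℕ λ k → Σ ℕ λ a → a < 2 × x ≡ 2 * k ×
           y ≡ suc (2 * (2 * i + a)) × bit k i ≡ a

record IsIso (D E : ℕ → ℕ → ℕ → Bool) (f : ℕ → ℕ) : Set where
  field
    injective  : ∀ x y → f x ≡ f y → x ≡ y
    surjective : ∀ y → Σ ℕ λ x → f x ≡ y
    pres-D     : ∀ i x y → HD i x y ⇔ (D i (f x) (f y) ≡ true)
    pres-E     : ∀ i x y → HE i x y ⇔ (E i (f x) (f y) ≡ true)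

IsCopyOfH : CompStr → Set
IsCopyOfH 𝒜 = Σ (ℕ → ℕ) (IsIso (CompStr.D 𝒜) (CompStr.E 𝒜))

ComputablyCategoricalH : Set
ComputablyCategoricalH =
  (𝒜 : CompStr) → IsCopyOfH 𝒜 →
  ¬ ¬ (Σ (ℕ → ℕ) λ f → Computable₁ f × IsIso (CompStr.D 𝒜) (CompStr.E 𝒜) f)

{-# OPTIONS --safe #-}
module Submission where

-- Any isomorphism g from H onto a computable copy is itself computable.
-- The E_j-neighbour of a finite set X is unique, namely X △ {j}, so g (X △ {j})
-- is found from g X by an unbounded search for the E_j-neighbour of g X; starting
-- from the constant g ∅ and toggling the elements of X one at a time computes g X.
-- Likewise g (i , a) is the unique D_i-partner of g X for any X with X(i) = a.

open import Defs
open import Data.Nat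
  using (ℕ; zero; suc; _+_; _*_; _∸_; _<_; _≤_; _/_; _%_; z≤n; s≤s; s≤s⁻¹; _<?_)
open import Data.Nat.Properties
open import Data.Nat.DivMod
open import Data.Nat.GeneralisedArithmetic using (fold; iterate; iterate-is-fold)
open import Data.Fin using (#_)
open import Data.Vec using (Vec; []; _∷_)
open import Data.Bool using (Bool; true; false)
open import Data.Product using (Σ; _,_; proj₁; proj₂)
open import Data.Sum using (inj₁; inj₂)
open import Data.Empty using (⊥-elim)
open import Relation.Binary.PropositionalEquality
open import Relation.Nullary using (yes; no)
open import Function.Base using (_∘_)
open import Function.Bundles using (_⇔_; Equivalence)

ifZero : ℕ → ℕ → ℕ → ℕ
ifZero zero    x y = x
ifZero (suc _) x y = y

ifZero-map : ∀ (f : ℕ → ℕ) b x y → f (ifZero b x y) ≡ ifZero b (f x) (f y)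
ifZero-map f zero    x y = refl
ifZero-map f (suc _) x y = refl

%2-suc : ∀ k → suc k % 2 ≡ 1 ∸ k % 2
%2-suc zero          = refl
%2-suc (suc zero)    = refl
%2-suc (suc (suc k)) = %2-suc k

/2-suc-suc : ∀ k → suc (suc k) / 2 ≡ suc (k / 2)
/2-suc-suc k = m/n≡1+[m∸n]/n {suc (suc k)} {2} (s≤s (s≤s z≤n))

/2-suc : ∀ k → suc k / 2 ≡ k / 2 + k % 2
/2-suc zero          = refl
/2-suc (suc zero)    = refl
/2-suc (suc (suc k)) = begin
  suc (suc (suc k)) / 2     ≡⟨ /2-suc-suc (suc k) ⟩
  suc (suc k / 2)           ≡⟨ cong suc (/2-suc k) ⟩
  suc (k / 2) + k % 2       ≡⟨ cong (_+ k % 2) (/2-suc-suc k) ⟨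
  suc (suc k) / 2 + k % 2   ∎
  where open ≡-Reasoning

2*[n/2]+n%2≡n : ∀ n → 2 * (n / 2) + n % 2 ≡ n
2*[n/2]+n%2≡n n = begin
  2 * (n / 2) + n % 2 ≡⟨ +-comm (2 * (n / 2)) (n % 2) ⟩
  n % 2 + 2 * (n / 2) ≡⟨ cong (n % 2 +_) (*-comm 2 (n / 2)) ⟩
  n % 2 + n / 2 * 2   ≡⟨ m≡m%n+[m/n]*n n 2 ⟨
  n                   ∎
  where open ≡-Reasoning

ifZero-parity : ∀ n → ifZero (n % 2) (2 * (n / 2)) (suc (2 * (n / 2))) ≡ n
ifZero-parity n with n % 2 | 2*[n/2]+n%2≡n n | m%n<n n 2
... | zero          | eq | _ = trans (sym (+-identityʳ _)) eq
... | suc zero      | eq | _ = trans (+-comm 1 _) eq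
... | suc (suc _)   | _  | s≤s (s≤s ())

[a+b*2]%2≡a : ∀ {a} b → a < 2 → (a + b * 2) % 2 ≡ a
[a+b*2]%2≡a {a} b a<2 = trans ([m+kn]%n≡m%n a b 2) (m<n⇒m%n≡m a<2)

[a+b*2]/2≡b : ∀ {a} b → a < 2 → (a + b * 2) / 2 ≡ b
[a+b*2]/2≡b {a} b a<2 = begin
  (a + b * 2) / 2   ≡⟨ +-distrib-/ a (b * 2) no-carry ⟩
  a / 2 + b * 2 / 2 ≡⟨ cong₂ _+_ (m<n⇒m/n≡0 a<2) (m*n/n≡m b 2) ⟩
  b                 ∎
  where
  open ≡-Reasoning
  no-carry : a % 2 + b * 2 % 2 < 2
  no-carry = subst (_< 2)
    (sym (trans (cong₂ _+_ (m<n⇒m%n≡m a<2) (m*n%n≡0 b 2)) (+-identityʳ a))) a<2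

bit<2 : ∀ k j → bit k j < 2
bit<2 k zero    = m%n<n k 2
bit<2 k (suc j) = bit<2 (k / 2) j

bit-digit-zero : ∀ {a} b → a < 2 → bit (a + b * 2) 0 ≡ a
bit-digit-zero = [a+b*2]%2≡a

bit-digit-suc : ∀ {a} b j → a < 2 → bit (a + b * 2) (suc j) ≡ bit b j
bit-digit-suc b j a<2 = cong (λ n → bit n j) ([a+b*2]/2≡b b a<2)

m≤1+n⇒m/2≤n : ∀ {m} n → m ≤ suc n → m / 2 ≤ n
m≤1+n⇒m/2≤n {zero}  n _   = z≤n
m≤1+n⇒m/2≤n {suc m} n m≤n = s≤s⁻¹ (≤-trans (m/n<m (suc m) 2 (s≤s (s≤s z≤n))) m≤n)

≤⇒bit≡0 : ∀ {k} j → k ≤ j → bit k j ≡ 0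
≤⇒bit≡0 zero    z≤n = refl
≤⇒bit≡0 (suc j) k≤j = ≤⇒bit≡0 j (m≤1+n⇒m/2≤n j k≤j)

bit-ext : ∀ {k l} → (∀ j → bit k j ≡ bit l j) → k ≡ l
bit-ext {k} {l} = bounded (k + l) (m≤m+n k l) (m≤n+m l k)
  where
  bounded : ∀ n {k l} → k ≤ n → l ≤ n → (∀ j → bit k j ≡ bit l j) → k ≡ l
  bounded zero    z≤n z≤n _ = refl
  bounded (suc n) {k} {l} k≤n l≤n same = begin
    k                 ≡⟨ m≡m%n+[m/n]*n k 2 ⟩
    k % 2 + k / 2 * 2 ≡⟨ cong₂ (λ a b → a + b * 2) (same 0) halves ⟩
    l % 2 + l / 2 * 2 ≡⟨ m≡m%n+[m/n]*n l 2 ⟨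
    l                 ∎
    where
    open ≡-Reasoning
    halves : k / 2 ≡ l / 2
    halves = bounded n (m≤1+n⇒m/2≤n n k≤n) (m≤1+n⇒m/2≤n n l≤n) (λ j → same (suc j))

1∸n<2 : ∀ n → 1 ∸ n < 2
1∸n<2 n = s≤s (m∸n≤m 1 n)

1∸n≢n : ∀ n → 1 ∸ n ≢ n
1∸n≢n zero    ()
1∸n≢n (suc n) eq = 0≢1+n (trans (sym (0∸n≡0 n)) eq)

≢⇒≡1∸ : ∀ {a b} → a < 2 → b < 2 → a ≢ b → a ≡ 1 ∸ b
≢⇒≡1∸ {0}     {0}     _ _ a≢b = ⊥-elim (a≢b refl)
≢⇒≡1∸ {0}     {1}     _ _ _   = refl
≢⇒≡1∸ {1}     {0}     _ _ _   = refl
≢⇒≡1∸ {1}     {1}     _ _ a≢b = ⊥-elim (a≢b refl)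
≢⇒≡1∸ {suc (suc _)} (s≤s (s≤s ())) _ _
≢⇒≡1∸ {_} {suc (suc _)} _ (s≤s (s≤s ())) _

toggle : ℕ → ℕ → ℕ
toggle k zero    = (1 ∸ k % 2) + k / 2 * 2
toggle k (suc j) = k % 2 + toggle (k / 2) j * 2

bit-toggle-≡ : ∀ k j → bit (toggle k j) j ≡ 1 ∸ bit k j
bit-toggle-≡ k zero    = bit-digit-zero (k / 2) (1∸n<2 (k % 2))
bit-toggle-≡ k (suc j) =
  trans (bit-digit-suc (toggle (k / 2) j) j (m%n<n k 2)) (bit-toggle-≡ (k / 2) j)

bit-toggle-≢ : ∀ k {i} j → i ≢ j → bit (toggle k j) i ≡ bit k i
bit-toggle-≢ k {zero}  zero    i≢j = ⊥-elim (i≢j refl)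
bit-toggle-≢ k {suc i} zero    _   = bit-digit-suc (k / 2) i (1∸n<2 (k % 2))
bit-toggle-≢ k {zero}  (suc j) _   = bit-digit-zero (toggle (k / 2) j) (m%n<n k 2)
bit-toggle-≢ k {suc i} (suc j) i≢j =
  trans (bit-digit-suc (toggle (k / 2) j) i (m%n<n k 2))
        (bit-toggle-≢ (k / 2) j (i≢j ∘ cong suc))

-- Sets bit j of k to b, provided that bit is 0.
setBit : ℕ → ℕ → ℕ → ℕ
setBit b k j = ifZero b k (toggle k j)

bit-setBit-≡ : ∀ {b} k j → b < 2 → bit k j ≡ 0 → bit (setBit b k j) j ≡ b
bit-setBit-≡ {0} k j _ bit≡0 = bit≡0
bit-setBit-≡ {1} k j _ bit≡0 = trans (bit-toggle-≡ k j) (cong (1 ∸_) bit≡0)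
bit-setBit-≡ {suc (suc _)} k j (s≤s (s≤s ())) _

bit-setBit-≢ : ∀ b k {i} j → i ≢ j → bit (setBit b k j) i ≡ bit k i
bit-setBit-≢ zero    k j _   = refl
bit-setBit-≢ (suc _) k j i≢j = bit-toggle-≢ k j i≢j

truncate : ℕ → ℕ → ℕ
truncate k zero    = 0
truncate k (suc j) = setBit (bit k j) (truncate k j) j

bit-truncate-≥ : ∀ k {i} j → j ≤ i → bit (truncate k j) i ≡ 0
bit-truncate-≥ k {i} zero    _     = ≤⇒bit≡0 i z≤n
bit-truncate-≥ k     (suc j) j<i =
  trans (bit-setBit-≢ (bit k j) (truncate k j) j (>⇒≢ j<i)) (bit-truncate-≥ k j (<⇒≤ j<i))

bit-truncate-< : ∀ k {i} j → i < j → bit (truncate k j) i ≡ bit k i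
bit-truncate-< k (suc j) i<1+j with m<1+n⇒m<n∨m≡n i<1+j
... | inj₁ i<j  =
  trans (bit-setBit-≢ (bit k j) (truncate k j) j (<⇒≢ i<j)) (bit-truncate-< k j i<j)
... | inj₂ refl = bit-setBit-≡ (truncate k j) j (bit<2 k j) (bit-truncate-≥ k j ≤-refl)

truncate-≥ : ∀ {k} j → k ≤ j → truncate k j ≡ k
truncate-≥ {k} j k≤j = bit-ext same
  where
  same : ∀ i → bit (truncate k j) i ≡ bit k i
  same i with i <? j
  ... | yes i<j = bit-truncate-< k j i<j
  ... | no  i≮j =
    trans (bit-truncate-≥ k j (≮⇒≥ i≮j)) (sym (≤⇒bit≡0 i (≤-trans k≤j (≮⇒≥ i≮j))))

pairCode : ℕ → ℕ → ℕ
pairCode i a = suc (2 * (2 * i + a))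

HE-toggle : ∀ m j → HE j (2 * m) (2 * toggle m j)
HE-toggle m j =
  m , toggle m j , refl , refl ,
  (λ i i≢j → sym (bit-toggle-≢ m j i≢j)) ,
  (λ eq → 1∸n≢n (bit m j) (trans (sym (bit-toggle-≡ m j)) (sym eq)))

HE-unique : ∀ {m j x} → HE j (2 * m) x → x ≡ 2 * toggle m j
HE-unique {m} {j} (m′ , l , 2m≡2m′ , x≡2l , agree , differ)
  rewrite *-cancelˡ-≡ m m′ 2 2m≡2m′ = trans x≡2l (cong (2 *_) (bit-ext same))
  where
  same : ∀ i → bit l i ≡ bit (toggle m′ j) i
  same i with i ≟ j
  ... | yes refl =
    trans (≢⇒≡1∸ (bit<2 l i) (bit<2 m′ i) (differ ∘ sym)) (sym (bit-toggle-≡ m′ i))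
  ... | no  i≢j  = trans (sym (agree i i≢j)) (sym (bit-toggle-≢ m′ j i≢j))

HD-bit : ∀ m i → HD i (2 * m) (pairCode i (bit m i))
HD-bit m i = m , bit m i , bit<2 m i , refl , refl , refl

HD-unique : ∀ {m i y} → HD i (2 * m) y → y ≡ pairCode i (bit m i)
HD-unique {m} {i} (m′ , a , _ , 2m≡2m′ , y≡ , bit≡a)
  rewrite *-cancelˡ-≡ m m′ 2 2m≡2m′ | bit≡a = y≡

⇓-≡ : ∀ {n} {e : Code n} {xs y y′} → e ⟦ xs ⟧⇓ y → y ≡ y′ → e ⟦ xs ⟧⇓ y′
⇓-≡ e⇓y refl = e⇓y

constᶜ : ∀ {n} → ℕ → Code n
constᶜ zero    = zer
constᶜ (suc c) = comp succ (constᶜ c ∷ [])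

⇓constᶜ : ∀ {n} c {xs : Vec ℕ n} → constᶜ c ⟦ xs ⟧⇓ c
⇓constᶜ zero    = ⇓zer
⇓constᶜ (suc c) = ⇓comp (⇓constᶜ c ∷ []) ⇓succ

notᶜ : Code 1
notᶜ = prec (constᶜ 1) zer

⇓notᶜ : ∀ x → notᶜ ⟦ x ∷ [] ⟧⇓ (1 ∸ x)
⇓notᶜ zero    = ⇓prec0 (⇓constᶜ 1)
⇓notᶜ (suc x) = ⇓-≡ (⇓precS (⇓notᶜ x) ⇓zer) (sym (0∸n≡0 x))

ifZeroᶜ : Code 3
ifZeroᶜ = prec (proj (# 0)) (proj (# 3))

⇓ifZeroᶜ : ∀ b x y → ifZeroᶜ ⟦ b ∷ x ∷ y ∷ [] ⟧⇓ ifZero b x y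
⇓ifZeroᶜ zero    x y = ⇓prec0 ⇓proj
⇓ifZeroᶜ (suc b) x y = ⇓precS (⇓ifZeroᶜ b x y) ⇓proj

addᶜ : Code 2
addᶜ = prec (proj (# 0)) (comp succ (proj (# 1) ∷ []))

⇓addᶜ : ∀ x y → addᶜ ⟦ x ∷ y ∷ [] ⟧⇓ (x + y)
⇓addᶜ zero    y = ⇓prec0 ⇓proj
⇓addᶜ (suc x) y = ⇓precS (⇓addᶜ x y) (⇓comp (⇓proj ∷ []) ⇓succ)

parityᶜ : Code 1
parityᶜ = prec zer (comp notᶜ (proj (# 1) ∷ []))

⇓parityᶜ : ∀ x → parityᶜ ⟦ x ∷ [] ⟧⇓ (x % 2)
⇓parityᶜ zero    = ⇓prec0 ⇓zer
⇓parityᶜ (suc x) =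
  ⇓-≡ (⇓precS (⇓parityᶜ x) (⇓comp (⇓proj ∷ []) (⇓notᶜ (x % 2)))) (sym (%2-suc x))

halfᶜ : Code 1
halfᶜ = prec zer (comp addᶜ (proj (# 1) ∷ comp parityᶜ (proj (# 0) ∷ []) ∷ []))

⇓halfᶜ : ∀ x → halfᶜ ⟦ x ∷ [] ⟧⇓ (x / 2)
⇓halfᶜ zero    = ⇓prec0 ⇓zer
⇓halfᶜ (suc x) = ⇓-≡
  (⇓precS (⇓halfᶜ x)
    (⇓comp (⇓proj ∷ ⇓comp (⇓proj ∷ []) (⇓parityᶜ x) ∷ []) (⇓addᶜ (x / 2) (x % 2))))
  (sym (/2-suc x))

foldᶜ : Code 1 → Code 2
foldᶜ f = prec (proj (# 0)) (comp f (proj (# 1) ∷ []))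

⇓foldᶜ : ∀ {f : Code 1} {F : ℕ → ℕ} → (∀ x → f ⟦ x ∷ [] ⟧⇓ F x) →
         ∀ j x → foldᶜ f ⟦ j ∷ x ∷ [] ⟧⇓ fold x F j
⇓foldᶜ f⇓F zero    x = ⇓prec0 ⇓proj
⇓foldᶜ f⇓F (suc j) x = ⇓precS (⇓foldᶜ f⇓F j x) (⇓comp (⇓proj ∷ []) (f⇓F _))

bit≡iterate : ∀ k j → bit k j ≡ iterate (_/ 2) k j % 2
bit≡iterate k zero    = refl
bit≡iterate k (suc j) = bit≡iterate (k / 2) j

bitᶜ : Code 2
bitᶜ = comp parityᶜ (foldᶜ halfᶜ ∷ [])

⇓bitᶜ : ∀ j k → bitᶜ ⟦ j ∷ k ∷ [] ⟧⇓ bit k j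
⇓bitᶜ j k = ⇓-≡ (⇓comp (⇓foldᶜ ⇓halfᶜ j k ∷ []) (⇓parityᶜ _))
  (sym (trans (bit≡iterate k j) (cong (_% 2) (sym (iterate-is-fold k (_/ 2) j)))))

findᶜ : ∀ {n} → Code (suc n) → Code n
findᶜ e = mu (comp notᶜ (e ∷ []))

⇓findᶜ : ∀ {n} {e : Code (suc n)} {xs : Vec ℕ n} (P : ℕ → Bool) {w} →
         (∀ y → e ⟦ y ∷ xs ⟧⇓ bool→ℕ (P y)) →
         P w ≡ true → (∀ {y} → P y ≡ true → y ≡ w) →
         findᶜ e ⟦ xs ⟧⇓ w
⇓findᶜ P {w} e⇓P Pw unique = ⇓mu (⇓-≡ (test w) (cong (λ b → 1 ∸ bool→ℕ b) Pw)) below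
  where
  test : ∀ y → comp notᶜ _ ⟦ y ∷ _ ⟧⇓ (1 ∸ bool→ℕ (P y))
  test y = ⇓comp (e⇓P y ∷ []) (⇓notᶜ _)
  below : ∀ y → y < w → Σ ℕ λ r → comp notᶜ _ ⟦ y ∷ _ ⟧⇓ suc r
  below y y<w with P y in Py
  ... | false = 0 , ⇓-≡ (test y) (cong (λ b → 1 ∸ bool→ℕ b) Py)
  ... | true  = ⊥-elim (<⇒≢ y<w (unique Py))

module IsoComputable (𝒜 : CompStr) (g : ℕ → ℕ)
                     (iso : IsIso (CompStr.D 𝒜) (CompStr.E 𝒜) g) where
  open CompStr 𝒜
  open IsIso iso

  image-unique : ∀ (R : ℕ → ℕ → Set) (Q : ℕ → ℕ → Bool) →
                 (∀ x y → R x y ⇔ Q (g x) (g y) ≡ true) →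
                 ∀ {a z} → (∀ {x} → R a x → x ≡ z) →
                 ∀ {y} → Q (g a) y ≡ true → y ≡ g z
  image-unique R Q preserves {a} unique {y} Qy with surjective y
  ... | x , refl = cong g (unique (Equivalence.from (preserves a x) Qy))

  nextᶜ : Code 2
  nextᶜ = findᶜ (comp (proj₁ E-computable) (proj (# 2) ∷ proj (# 1) ∷ proj (# 0) ∷ []))

  ⇓nextᶜ : ∀ m j → nextᶜ ⟦ g (2 * m) ∷ j ∷ [] ⟧⇓ g (2 * toggle m j)
  ⇓nextᶜ m j = ⇓findᶜ (E j (g (2 * m)))
    (λ y → ⇓comp (⇓proj ∷ ⇓proj ∷ ⇓proj ∷ []) (proj₂ E-computable j (g (2 * m)) y))
    (Equivalence.to (pres-E j (2 * m) (2 * toggle m j)) (HE-toggle m j))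
    (image-unique (HE j) (E j) (pres-E j) HE-unique)

  setBitᶜ : Code 3
  setBitᶜ = comp ifZeroᶜ
    (proj (# 0) ∷ proj (# 1) ∷ comp nextᶜ (proj (# 1) ∷ proj (# 2) ∷ []) ∷ [])

  ⇓setBitᶜ : ∀ b m j → setBitᶜ ⟦ b ∷ g (2 * m) ∷ j ∷ [] ⟧⇓ g (2 * setBit b m j)
  ⇓setBitᶜ b m j = ⇓-≡
    (⇓comp (⇓proj ∷ ⇓proj ∷ ⇓comp (⇓proj ∷ ⇓proj ∷ []) (⇓nextᶜ m j) ∷ []) (⇓ifZeroᶜ b _ _))
    (sym (ifZero-map (λ k → g (2 * k)) b m (toggle m j)))

  walkᶜ : Code 2
  walkᶜ = prec (constᶜ (g 0))
    (comp setBitᶜ (comp bitᶜ (proj (# 0) ∷ proj (# 2) ∷ []) ∷ proj (# 1) ∷ proj (# 0) ∷ []))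

  ⇓walkᶜ : ∀ j k → walkᶜ ⟦ j ∷ k ∷ [] ⟧⇓ g (2 * truncate k j)
  ⇓walkᶜ zero    k = ⇓prec0 (⇓constᶜ (g 0))
  ⇓walkᶜ (suc j) k = ⇓precS (⇓walkᶜ j k)
    (⇓comp (⇓comp (⇓proj ∷ ⇓proj ∷ []) (⇓bitᶜ j k) ∷ ⇓proj ∷ ⇓proj ∷ [])
           (⇓setBitᶜ (bit k j) (truncate k j) j))

  setᶜ : Code 1
  setᶜ = comp walkᶜ (proj (# 0) ∷ proj (# 0) ∷ [])

  ⇓setᶜ : ∀ k → setᶜ ⟦ k ∷ [] ⟧⇓ g (2 * k)
  ⇓setᶜ k = ⇓-≡ (⇓comp (⇓proj ∷ ⇓proj ∷ []) (⇓walkᶜ k k))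
                (cong (λ n → g (2 * n)) (truncate-≥ k ≤-refl))

  pairᶜ : Code 2
  pairᶜ = findᶜ (comp (proj₁ D-computable) (proj (# 1) ∷ witnessᶜ ∷ proj (# 0) ∷ []))
    where
    witnessᶜ : Code 3
    witnessᶜ = comp setBitᶜ (proj (# 2) ∷ constᶜ (g 0) ∷ proj (# 1) ∷ [])

  ⇓pairᶜ : ∀ i {a} → a < 2 → pairᶜ ⟦ i ∷ a ∷ [] ⟧⇓ g (pairCode i a)
  ⇓pairᶜ i {a} a<2 = ⇓-≡
    (⇓findᶜ (D i (g (2 * m)))
      (λ y → ⇓comp (⇓proj ∷ ⇓comp (⇓proj ∷ ⇓constᶜ (g 0) ∷ ⇓proj ∷ []) (⇓setBitᶜ a 0 i)
                          ∷ ⇓proj ∷ [])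
                   (proj₂ D-computable i (g (2 * m)) y))
      (Equivalence.to (pres-D i (2 * m) (pairCode i (bit m i))) (HD-bit m i))
      (image-unique (HD i) (D i) (pres-D i) (HD-unique {m} {i})))
    (cong (λ b → g (pairCode i b)) (bit-setBit-≡ 0 i a<2 (≤⇒bit≡0 i z≤n)))
    where
    m : ℕ
    m = setBit a 0 i

  decodeᶜ : Code 1
  decodeᶜ = comp ifZeroᶜ
    (parityᶜ ∷ comp setᶜ (halfᶜ ∷ []) ∷
     comp pairᶜ (comp halfᶜ (halfᶜ ∷ []) ∷ comp parityᶜ (halfᶜ ∷ []) ∷ []) ∷ [])

  ⇓decodeᶜ : ∀ x → decodeᶜ ⟦ x ∷ [] ⟧⇓ g x
  ⇓decodeᶜ x = ⇓-≡
    (⇓comp (⇓parityᶜ x ∷ ⇓comp (⇓halfᶜ x ∷ []) (⇓setᶜ q) ∷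
            ⇓comp (⇓comp (⇓halfᶜ x ∷ []) (⇓halfᶜ q) ∷ ⇓comp (⇓halfᶜ x ∷ []) (⇓parityᶜ q) ∷ [])
                  (⇓pairᶜ (q / 2) (m%n<n q 2)) ∷ [])
           (⇓ifZeroᶜ (x % 2) _ _))
    (begin
      ifZero (x % 2) (g (2 * q)) (g (pairCode (q / 2) (q % 2))) ≡⟨ ifZero-map g (x % 2) _ _ ⟨
      g (ifZero (x % 2) (2 * q) (suc (2 * (2 * (q / 2) + q % 2))))
        ≡⟨ cong (λ n → g (ifZero (x % 2) (2 * q) (suc (2 * n)))) (2*[n/2]+n%2≡n q) ⟩
      g (ifZero (x % 2) (2 * q) (suc (2 * q)))            ≡⟨ cong g (ifZero-parity x) ⟩
      g x                                                 ∎)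
    where
    open ≡-Reasoning
    q : ℕ
    q = x / 2

  computable : Computable₁ g
  computable = decodeᶜ , ⇓decodeᶜ

corollary3p11 : ComputablyCategoricalH
corollary3p11 𝒜 (g , iso) no-computable-iso =
  no-computable-iso (g , IsoComputable.computable 𝒜 g iso , iso)
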